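{- Let $1\le s\le r$ be integers and $t\ge 0$. Suppose there exists a hypergraph $H$ with vertex set $[r]=\{1,\dots,r\}$ such that (i) $e\cap f\neq\emptyset$ for all $e,f\in E(H)$ (i.e. $H$ is intersecting), and (ii) every set of $r-s$ vertices of $H$ contains (as subsets) at least $t$ distinct edges of $H$. Then for every positive integer $n$, $$g(n,r,s)\le n-t\cdot\left\lfloor\frac{n}{|E(H)|}\right\rfloor.$$
   Context: An $r$-edge colouring of $K_n$ assigns to each edge one of $r$ colours. $g(n,r,s)$ denotes the largest integer $m$ such that in every $r$-edge colouring of $K_n$ there is a set $S$ of at most $s$ colours such that at least $m$ vertices of $K_n$ are incident to at least one edge whose colour lies in $S$. A hypergraph on $[r]$ is a set of subsets (edges) of $[r]$. -}

module Defs where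

open import Data.Nat using (ℕ; zero; suc; _≤_; _∸_)
open import Data.Nat.DivMod using (_/_)
open import Data.Fin using (Fin)
open import Data.Fin.Subset using (Subset; _∈_; _∉_; _⊆_; _∩_; ∣_∣; Nonempty)
open import Data.Fin.Subset.Properties using (_⊆?_)
open import Data.List using (List; length; filter)
open import Data.List.Membership.Propositional renaming (_∈_ to _∈ₗ_)
open import Data.List.Relation.Unary.Unique.Propositional using (Unique)
open import Data.Product using (Σ; ∃; _×_)
open import Relation.Binary.PropositionalEquality using (_≡_; _≢_)

-- An r-edge colouring of K_n (vertices Fin n): each ordered pair gets a colour
-- in Fin r, symmetric, so each (unordered) edge {u,v}, u ≠ v, has one colour.
-- Values on the diagonal (u = u) are irrelevant: they are never used.
record Colouring (n r : ℕ) : Set where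
  field
    col : Fin n → Fin n → Fin r
    sym : ∀ u v → col u v ≡ col v u
open Colouring public

Incident : ∀ {n r} → Colouring n r → Subset r → Fin n → Set
Incident c S v = ∃ λ u → u ≢ v × col c v u ∈ S

CoversAtLeast : ∀ {n r} → Colouring n r → Subset r → ℕ → Set
CoversAtLeast {n} c S m = Σ (Subset n) λ T → (m ≤ ∣ T ∣) × (∀ v → v ∈ T → Incident c S v)

-- m is admissible for g(n,r,s): in every r-edge colouring of K_n there is a
-- set S of at most s colours covering at least m vertices.
-- g(n,r,s) is the largest admissible m.
Admissible : ℕ → ℕ → ℕ → ℕ → Set
Admissible n r s m = (c : Colouring n r) → Σ (Subset r) λ S → (∣ S ∣ ≤ s) × CoversAtLeast c S m

record Hypergraph (r : ℕ) : Set where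
  field
    edges  : List (Subset r)
    unique : Unique edges
open Hypergraph public

numEdges : ∀ {r} → Hypergraph r → ℕ
numEdges H = length (edges H)

Intersecting : ∀ {r} → Hypergraph r → Set
Intersecting H = ∀ e f → e ∈ₗ edges H → f ∈ₗ edges H → Nonempty (e ∩ f)

edgesInside : ∀ {r} → Hypergraph r → Subset r → ℕ
edgesInside H X = length (filter (_⊆? X) (edges H))

-- floor division; the value for divisor 0 is a convention (0)
_div_ : ℕ → ℕ → ℕ
n div zero    = 0
n div (suc k) = n / suc k

-- Fix an enumeration e₀, …, e_{k-1} of the edges of H and give vertex j the edge e_{j mod k}.
-- Colour uv with a colour common to the edges of u and v (H is intersecting), so every colour
-- seen at a vertex lies in that vertex's edge.  Given colours S with |S| ≤ s, pick X of size
-- r − s disjoint from S: a vertex whose edge lies inside X sees no colour of S.  Each of the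
-- ⌊n/k⌋ complete periods of the enumeration contains at least t such vertices.
module Submission where

open import Function using (_∘_)
open import Data.Bool using (Bool; true; false; if_then_else_)
open import Data.Nat using (ℕ; zero; suc; _+_; _*_; _∸_; _≤_; _<_; z≤n; s≤s; NonZero)
open import Data.Nat.Properties
open import Data.Nat.DivMod using (_/_; _%_; [m+n]%n≡m%n; m<n⇒m%n≡m; m%n<n; m/n*n≤m)
open import Data.Fin using (Fin; toℕ) renaming (zero to fzero)
open import Data.Fin.Subset using (Subset; ∣_∣; Nonempty; _∈_; _⊆_; _∩_; ∁; ⊥; inside; outside)
open import Data.Fin.Subset.Properties
  using (nonempty?; _⊆?_; ⊥⊆; s⊆s; ∣⊥∣≡0; ∣p∣≤n; ∣∁p∣≡n∸∣p∣; ∩-comm; x∈p∩q⁻; x∈∁p⇒x∉p; ⊆-trans)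
open import Data.Vec using ([]; _∷_; here; there)
open import Data.List using (List; length; filter) renaming ([] to []ₗ; _∷_ to _∷ₗ_)
open import Data.List.Membership.Propositional using () renaming (_∈_ to _∈ₗ_)
open import Data.List.Relation.Unary.Any using () renaming (here to hereₗ; there to thereₗ)
open import Data.Product using (Σ; _×_; _,_; proj₁)
open import Data.Empty using (⊥-elim)
open import Relation.Unary using (Decidable)
open import Relation.Nullary using (¬_; yes; no; does)
open import Relation.Nullary.Decidable using (dec-false)
open import Relation.Binary.PropositionalEquality
  using (_≡_; refl; trans; cong; cong₂; module ≡-Reasoning) renaming (sym to ≡-sym)

open import Defs

count : (ℕ → Bool) → ℕ → ℕ
count f zero    = 0
count f (suc n) = (if f 0 then 1 else 0) + count (f ∘ suc) n

count-+ : ∀ (f : ℕ → Bool) a b → count f (a + b) ≡ count f a + count (λ j → f (a + j)) b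
count-+ f zero    b = refl
count-+ f (suc a) b =
  trans (cong ((if f 0 then 1 else 0) +_) (count-+ (f ∘ suc) a b))
        (≡-sym (+-assoc (if f 0 then 1 else 0) _ _))

count-cong : ∀ {f g : ℕ → Bool} n → (∀ {j} → j < n → f j ≡ g j) → count f n ≡ count g n
count-cong zero    f≡g = refl
count-cong (suc n) f≡g =
  cong₂ _+_ (cong (λ b → if b then 1 else 0) (f≡g (s≤s z≤n))) (count-cong n (f≡g ∘ s≤s))

count-mono : ∀ (f : ℕ → Bool) {a n} → a ≤ n → count f a ≤ count f n
count-mono f {a} {n} a≤n = begin
  count f a                                              ≤⟨ m≤m+n _ _ ⟩
  count f a + count (λ j → f (a + j)) (n ∸ a)            ≡⟨ count-+ f a (n ∸ a) ⟨
  count f (a + (n ∸ a))                                  ≡⟨ cong (count f) (m+[n∸m]≡n a≤n) ⟩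
  count f n                                              ∎
  where open ≤-Reasoning

count-%-* : ∀ (g : ℕ → Bool) k .{{_ : NonZero k}} q →
            count (λ j → g (j % k)) (q * k) ≡ q * count g k
count-%-* g k zero    = refl
count-%-* g k (suc q) = begin
  count (λ j → g (j % k)) (k + q * k)                                ≡⟨ count-+ _ k (q * k) ⟩
  count (λ j → g (j % k)) k + count (λ j → g ((k + j) % k)) (q * k)  ≡⟨ cong₂ _+_ period-start shift ⟩
  count g k + q * count g k                                          ∎
  where
  open ≡-Reasoning
  period-start : count (λ j → g (j % k)) k ≡ count g k
  period-start = count-cong k (cong g ∘ m<n⇒m%n≡m)
  shift : count (λ j → g ((k + j) % k)) (q * k) ≡ q * count g k
  shift = trans (count-cong (q * k) (λ {j} _ → cong g (%-period j))) (count-%-* g k q)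
    where
    %-period : ∀ j → (k + j) % k ≡ j % k
    %-period j = trans (cong (_% k) (+-comm k j)) ([m+n]%n≡m%n j k)

count-% : ∀ (g : ℕ → Bool) k .{{_ : NonZero k}} n → n / k * count g k ≤ count (λ j → g (j % k)) n
count-% g k n = begin
  n / k * count g k                      ≡⟨ count-%-* g k (n / k) ⟨
  count (λ j → g (j % k)) (n / k * k)    ≤⟨ count-mono _ (m/n*n≤m n k) ⟩
  count (λ j → g (j % k)) n              ∎
  where open ≤-Reasoning

∣p∣+count≤n : ∀ {n} (p : Subset n) (f : ℕ → Bool) →
              (∀ {v} → v ∈ p → f (toℕ v) ≡ false) → ∣ p ∣ + count f n ≤ n
∣p∣+count≤n []            f f≡false = z≤n
∣p∣+count≤n (inside ∷ p)  f f≡false rewrite f≡false here =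
  s≤s (∣p∣+count≤n p (f ∘ suc) (f≡false ∘ there))
∣p∣+count≤n (outside ∷ p) f f≡false with f 0 | ∣p∣+count≤n p (f ∘ suc) (f≡false ∘ there)
... | true  | ih = ≤-trans (≤-reflexive (+-suc ∣ p ∣ _)) (s≤s ih)
... | false | ih = m≤n⇒m≤1+n ih

⊆-ofSize : ∀ {n} (p : Subset n) {a} → a ≤ ∣ p ∣ → Σ (Subset n) λ q → q ⊆ p × ∣ q ∣ ≡ a
⊆-ofSize {n} p             {zero}  _ = ⊥ , ⊥⊆ , ∣⊥∣≡0 n
⊆-ofSize (outside ∷ p)     {suc a} a≤∣p∣ with ⊆-ofSize p a≤∣p∣
... | q , q⊆p , ∣q∣≡a = outside ∷ q , s⊆s q⊆p , ∣q∣≡a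
⊆-ofSize (inside ∷ p)      {suc a} (s≤s a≤∣p∣) with ⊆-ofSize p a≤∣p∣
... | q , q⊆p , ∣q∣≡a = inside ∷ q , s⊆s q⊆p , cong suc ∣q∣≡a

∣p∣≤s⇒n∸s≤∣∁p∣ : ∀ {n s} (p : Subset n) → ∣ p ∣ ≤ s → n ∸ s ≤ ∣ ∁ p ∣
∣p∣≤s⇒n∸s≤∣∁p∣ {n} p ∣p∣≤s = ≤-trans (∸-monoʳ-≤ n ∣p∣≤s) (≤-reflexive (≡-sym (∣∁p∣≡n∸∣p∣ p)))

element : ∀ {n} (p : Subset n) → Nonempty p → Fin n
element p ne with nonempty? p
... | yes (x , _) = x
... | no  ¬ne     = ⊥-elim (¬ne ne)

element-∈ : ∀ {n} (p : Subset n) (ne : Nonempty p) → element p ne ∈ p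
element-∈ p ne with nonempty? p
... | yes (_ , x∈p) = x∈p
... | no  ¬ne       = ⊥-elim (¬ne ne)

element-cong : ∀ {n} {p q : Subset n} → p ≡ q → (a : Nonempty p) (b : Nonempty q) →
               element p a ≡ element q b
element-cong {p = p} refl a b with nonempty? p
... | yes _   = refl
... | no  ¬ne = ⊥-elim (¬ne a)

nth : {A : Set} → A → List A → ℕ → A
nth d []ₗ       j       = d
nth d (x ∷ₗ xs) zero    = x
nth d (x ∷ₗ xs) (suc j) = nth d xs j

nth-∈ : ∀ {A : Set} (d : A) (xs : List A) {j} → j < length xs → nth d xs j ∈ₗ xs
nth-∈ d (x ∷ₗ xs) {zero}  _         = hereₗ refl
nth-∈ d (x ∷ₗ xs) {suc j} (s≤s j<) = thereₗ (nth-∈ d xs j<)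

count-nth : ∀ {A : Set} {P : A → Set} (P? : Decidable P) (d : A) (xs : List A) →
            count (λ j → does (P? (nth d xs j))) (length xs) ≡ length (filter P? xs)
count-nth P? d []ₗ       = refl
count-nth P? d (x ∷ₗ xs) with does (P? x)
... | true  = cong suc (count-nth P? d xs)
... | false = count-nth P? d xs

-- `element` depends only on the set, not on the nonemptiness proof; this makes the colouring symmetric.
intersectionColouring : ∀ {n r} (E : Fin n → Subset r) → (∀ u v → Nonempty (E u ∩ E v)) → Colouring n r
intersectionColouring E meet = record
  { col = λ u v → element (E u ∩ E v) (meet u v)
  ; sym = λ u v → element-cong (∩-comm (E u) (E v)) (meet u v) (meet v u)
  }

intersectionColouring-∈ : ∀ {n r} (E : Fin n → Subset r) (meet : ∀ u v → Nonempty (E u ∩ E v)) →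
                          ∀ u v → col (intersectionColouring E meet) u v ∈ E u
intersectionColouring-∈ E meet u v = proj₁ (x∈p∩q⁻ (E u) (E v) (element-∈ _ (meet u v)))

¬Incident : ∀ {n r} (c : Colouring n r) (E : Fin n → Subset r) → (∀ u v → col c u v ∈ E u) →
            ∀ {S v} → E v ⊆ ∁ S → ¬ Incident c S v
¬Incident c E col∈E {v = v} Ev⊆∁S (u , _ , col∈S) = x∈∁p⇒x∉p (Ev⊆∁S (col∈E v u)) col∈S

covered+uncovered≤n : ∀ {n r} (c : Colouring n r) (E : ℕ → Subset r) →
                      (∀ u v → col c u v ∈ E (toℕ u)) →
                      ∀ {S X m} → X ⊆ ∁ S → CoversAtLeast c S m →
                      m + count (λ j → does (E j ⊆? X)) n ≤ n
covered+uncovered≤n c E col∈E {X = X} X⊆∁S (T , m≤∣T∣ , incident) =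
  ≤-trans (+-monoˡ-≤ _ m≤∣T∣) (∣p∣+count≤n T _ λ {v} v∈T →
    dec-false (E (toℕ v) ⊆? X)
              (λ Ev⊆X → ¬Incident c (E ∘ toℕ) col∈E (⊆-trans Ev⊆X X⊆∁S) (incident v v∈T)))

admissible⇒≤ : ∀ {n r s m} → Admissible n (suc r) s m → m ≤ n
admissible⇒≤ adm with adm (record { col = λ _ _ → fzero ; sym = λ _ _ → refl })
... | _ , _ , T , m≤∣T∣ , _ = ≤-trans m≤∣T∣ (∣p∣≤n T)

lemma2p2 : (r s t : ℕ) → 1 ≤ s → s ≤ r →
           (H : Hypergraph r) → Intersecting H →
           ((X : Subset r) → ∣ X ∣ ≡ r ∸ s → t ≤ edgesInside H X) →
           (n : ℕ) → 1 ≤ n →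
           (m : ℕ) → Admissible n r s m → m ≤ n ∸ t * (n div numEdges H)
lemma2p2 zero s t (s≤s _) () _ _ _ _ _ _ _
-- Without edges the divisor is 0, for which `div` returns 0, so only m ≤ n remains.
lemma2p2 (suc r) s t _ _ record { edges = []ₗ } _ _ n _ m adm
  rewrite *-zeroʳ t = admissible⇒≤ adm
lemma2p2 (suc r) s t _ _ H@record { edges = e₀ ∷ₗ es } intersecting dense n _ m adm =
  let c                   = intersectionColouring (E ∘ toℕ) meet
      S , ∣S∣≤s , covers  = adm c
      X , X⊆∁S , ∣X∣≡r∸s = ⊆-ofSize (∁ S) (∣p∣≤s⇒n∸s≤∣∁p∣ S ∣S∣≤s)
  in m+n≤o⇒m≤o∸n m (begin
       m + t * (n / k)                      ≤⟨ +-monoʳ-≤ m (*-monoˡ-≤ (n / k) (dense X ∣X∣≡r∸s)) ⟩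
       m + edgesInside H X * (n / k)        ≤⟨ +-monoʳ-≤ m (uncovered X) ⟩
       m + count (λ j → does (E j ⊆? X)) n  ≤⟨ covered+uncovered≤n c E col∈E X⊆∁S covers ⟩
       n                                    ∎)
  where
  open ≤-Reasoning
  k = numEdges H
  E : ℕ → Subset (suc r)
  E j = nth e₀ (edges H) (j % k)
  E∈H : ∀ j → E j ∈ₗ edges H
  E∈H j = nth-∈ e₀ (edges H) (m%n<n j k)
  meet : ∀ u v → Nonempty (E (toℕ u) ∩ E (toℕ v))
  meet u v = intersecting _ _ (E∈H (toℕ u)) (E∈H (toℕ v))
  col∈E : ∀ u v → col (intersectionColouring (E ∘ toℕ) meet) u v ∈ E (toℕ u)
  col∈E = intersectionColouring-∈ (E ∘ toℕ) meet
  uncovered : ∀ X → edgesInside H X * (n / k) ≤ count (λ j → does (E j ⊆? X)) n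
  uncovered X = begin
    edgesInside H X * (n / k)  ≡⟨ *-comm (edgesInside H X) (n / k) ⟩
    n / k * edgesInside H X    ≡⟨ cong (n / k *_) (count-nth (_⊆? X) e₀ (edges H)) ⟨
    n / k * count edge⊆X k     ≤⟨ count-% edge⊆X k n ⟩
    count (edge⊆X ∘ (_% k)) n  ∎
    where
    edge⊆X : ℕ → Bool
    edge⊆X j = does (nth e₀ (edges H) j ⊆? X)
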